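{- Let $p$ be a prime with $p\equiv 1\pmod 4$ and for an integer $n\ge 0$ define $$F(n)=4^{p-1}\prod_{\substack{j=0\\ j\neq \frac{p-1}{4}}}^{p-1}(1+4j+4np)^2\prod_{i=0}^{p-2}\frac{1}{(1+i+np)^2}.$$ Then for all positive integers $n$, $F(n)\equiv F(0)\equiv 1\pmod{p^2}$.
   Context: $F(n)$ is a rational number whose denominator is prime to $p$. For such rationals $x,y$, $x\equiv y\pmod{p^k}$ means that $x-y$, in lowest terms, has numerator divisible by $p^k$. -}

module Defs where

open import Data.Nat as ℕ using (ℕ; suc; _∸_; _^_)
open import Data.Nat.Divisibility using (_∣_)
open import Data.Nat.DivMod using (_/_)
open import Data.Integer using (+_; ∣_∣)
open import Data.Rational using (ℚ; ↥_; _-_; _*_; 1ℚ)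
import Data.Rational as Q
open import Data.List using (List; upTo; filter; foldr; map)
open import Relation.Nullary.Decidable using (¬?)

prodℚ : List ℚ → ℚ
prodℚ = foldr _*_ 1ℚ

ℕ→ℚ : ℕ → ℚ
ℕ→ℚ k = (+ k) Q./ 1

sq : ℚ → ℚ
sq x = x * x

F : ℕ → ℕ → ℚ
F p n =
  ℕ→ℚ (4 ^ (p ∸ 1))
  * prodℚ (map (λ j → sq (ℕ→ℚ (1 ℕ.+ 4 ℕ.* j ℕ.+ 4 ℕ.* n ℕ.* p)))
               (filter (λ j → ¬? (j ℕ.≟ (p ∸ 1) / 4)) (upTo p)))
  * prodℚ (map (λ i → sq ((+ 1) Q./ suc (i ℕ.+ n ℕ.* p))) (upTo (p ∸ 1)))

-- x ≡ y (mod m): the numerator of x - y in lowest terms is divisible by m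
_≡_[mod_] : ℚ → ℚ → ℕ → Set
x ≡ y [mod m ] = m ∣ ∣ (↥ (x - y)) ∣

module Submission where

open import Defs
open import Data.Nat using (ℕ; _%_; _^_; _≥_)
open import Data.Nat.Primality using (Prime)
open import Data.Rational using (1ℚ)
open import Data.Product using (_×_)
open import Relation.Binary.PropositionalEquality using (_≡_)
open import Data.Nat using (suc; _+_; _*_)
open import Data.Nat.DivMod using (_/_; m≡m%n+[m/n]*n)
open import Relation.Binary.PropositionalEquality using (subst; sym; trans; cong)

-- Corollary 4.2.  Let p = 4k + 1 be prime and write
--   F(n) = 4^(p-1) N(n)² / D(n)²,   N(n) = ∏_{j<p, j≠k} (1 + 4j + 4np),   D(n) = ∏_{i<p-1} (1 + i + np).
-- Then F(n) ≡ F(0) ≡ 1 (mod p²).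
--
-- Since p divides no factor of D(n), it suffices to prove the congruence of natural numbers
--   4^(p-1) N(n)² ≡ D(n)² (mod p²):
-- a fraction a/b with a ≡ b (mod p²) and p ∤ b is then ≡ 1, and two such fractions are
-- congruent to each other.  The congruence of naturals rests on three facts.
--   * Pairing.  The factors of N(n) and of D(n) fall into pairs {x + tp, y + tp} with p ∣ x + y,
--     and (x + tp)(y + tp) ≡ xy (mod p²); so N(n) ≡ Ñ := ∏_{j≠k} (1 + 4j) and D(n) ≡ (p-1)!.
--   * Reflection.  By the same pairing, W := ∏_{j≠k} (4p - (1 + 4j)) ≡ Ñ (mod p²).
--   * An exact identity D(2) D(3) = 4^(p-1) Ñ W, obtained by computing (4p)! once through
--     its blocks of length p and once through its odd and even factors.
-- Hence 4^(p-1) N(n)² ≡ 4^(p-1) Ñ² ≡ 4^(p-1) Ñ W = D(2) D(3) ≡ ((p-1)!)² ≡ D(n)².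

module RangeProducts where

  open import Data.Nat
  open import Data.Nat.Properties
  open import Data.Nat.Tactic.RingSolver using (solve-∀)
  open import Data.List using (List; []; _∷_; map; applyUpTo)
  open import Data.Nat.ListAction using (product)
  open import Algebra.Properties.CommutativeSemigroup *-commutativeSemigroup using (interchange)
  open import Function using (_∘_)
  open import Relation.Binary.PropositionalEquality
  open ≡-Reasoning

  Π : (ℕ → ℕ) → ℕ → ℕ
  Π f zero    = 1
  Π f (suc m) = f 0 * Π (f ∘ suc) m

  Π-cong : ∀ {f g} m → (∀ i → i < m → f i ≡ g i) → Π f m ≡ Π g m
  Π-cong zero    eq = refl
  Π-cong (suc m) eq = cong₂ _*_ (eq 0 z<s) (Π-cong m (λ i i<m → eq (suc i) (s<s i<m)))

  Π-ext : ∀ {f g} m → (∀ i → f i ≡ g i) → Π f m ≡ Π g m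
  Π-ext m eq = Π-cong m (λ i _ → eq i)

  Π-split : ∀ f a b → Π f (a + b) ≡ Π f a * Π (λ i → f (a + i)) b
  Π-split f zero    b = sym (+-identityʳ _)
  Π-split f (suc a) b = trans (cong (f 0 *_) (Π-split (f ∘ suc) a b)) (sym (*-assoc (f 0) _ _))

  Π-snoc : ∀ f m → Π f (suc m) ≡ Π f m * f m
  Π-snoc f zero    = *-comm (f 0) 1
  Π-snoc f (suc m) = trans (cong (f 0 *_) (Π-snoc (f ∘ suc) m)) (sym (*-assoc (f 0) _ _))

  Π-mul : ∀ f g m → Π (λ i → f i * g i) m ≡ Π f m * Π g m
  Π-mul f g zero    = refl
  Π-mul f g (suc m) = begin
    f 0 * g 0 * Π (λ i → f (suc i) * g (suc i)) m ≡⟨ cong (f 0 * g 0 *_) (Π-mul (f ∘ suc) (g ∘ suc) m) ⟩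
    f 0 * g 0 * (Π (f ∘ suc) m * Π (g ∘ suc) m)   ≡⟨ interchange (f 0) (g 0) _ _ ⟩
    f 0 * Π (f ∘ suc) m * (g 0 * Π (g ∘ suc) m)   ∎

  Π-scale : ∀ c f m → Π (λ i → c * f i) m ≡ c ^ m * Π f m
  Π-scale c f m = trans (Π-mul (λ _ → c) f m) (cong (_* Π f m) (Π-const m))
    where Π-const : ∀ m → Π (λ _ → c) m ≡ c ^ m
          Π-const zero    = refl
          Π-const (suc m) = cong (c *_) (Π-const m)

  Π-reverse : ∀ f m → Π f m ≡ Π (λ i → f (m ∸ suc i)) m
  Π-reverse f zero    = refl
  Π-reverse f (suc m) = begin
    f 0 * Π (f ∘ suc) m                        ≡⟨ cong (f 0 *_) (Π-reverse (f ∘ suc) m) ⟩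
    f 0 * Π (λ i → f (suc (m ∸ suc i))) m      ≡⟨ cong (f 0 *_) (Π-cong m (λ i i<m → cong f (sym (+-∸-assoc 1 i<m)))) ⟩
    f 0 * Π (λ i → f (suc m ∸ suc i)) m        ≡⟨ *-comm (f 0) _ ⟩
    Π (λ i → f (suc m ∸ suc i)) m * f 0        ≡⟨ cong (λ z → Π (λ i → f (suc m ∸ suc i)) m * f z) (sym (n∸n≡0 m)) ⟩
    Π (λ i → f (suc m ∸ suc i)) m * f (m ∸ m)  ≡⟨ Π-snoc (λ i → f (suc m ∸ suc i)) m ⟨
    Π (λ i → f (suc m ∸ suc i)) (suc m)        ∎

  Π-zip-reverse : ∀ f g m → Π f m * Π g m ≡ Π (λ i → f i * g (m ∸ suc i)) m
  Π-zip-reverse f g m = trans (cong (Π f m *_) (Π-reverse g m)) (sym (Π-mul f _ m))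

  Π-halves : ∀ f m → Π f (m + m) ≡ Π (λ i → f i * f (m + (m ∸ suc i))) m
  Π-halves f m = trans (Π-split f m m) (Π-zip-reverse f (λ i → f (m + i)) m)

  Π-evenodd : ∀ f m → Π f (m + m) ≡ Π (λ i → f (i + i)) m * Π (λ i → f (suc (i + i))) m
  Π-evenodd f zero    = refl
  Π-evenodd f (suc m) = begin
    Π f (suc (m + suc m))                      ≡⟨ cong (Π f ∘ suc) (+-suc m m) ⟩
    f 0 * (f 1 * Π (f ∘ suc ∘ suc) (m + m))    ≡⟨ cong (λ z → f 0 * (f 1 * z)) (Π-evenodd (f ∘ suc ∘ suc) m) ⟩
    f 0 * (f 1 * (Π even m * Π odd m))         ≡⟨ regroup (f 0) (f 1) _ _ ⟩
    f 0 * Π even m * (f 1 * Π odd m)           ≡⟨ cong₂ (λ a b → f 0 * a * (f 1 * b)) (Π-ext m shift-even) (Π-ext m shift-odd) ⟨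
    Π (λ i → f (i + i)) (suc m) * Π (λ i → f (suc (i + i))) (suc m) ∎
    where
    even odd : ℕ → ℕ
    even i = f (suc (suc (i + i)))
    odd  i = f (suc (suc (suc (i + i))))
    shift-even : ∀ i → f (suc i + suc i) ≡ even i
    shift-even i = cong f (+-suc (suc i) i)
    shift-odd : ∀ i → f (suc (suc i + suc i)) ≡ odd i
    shift-odd i = cong (f ∘ suc) (+-suc (suc i) i)
    regroup : ∀ a b c d → a * (b * (c * d)) ≡ a * c * (b * d)
    regroup = solve-∀

  Π-factorial : ∀ m → Π suc m ≡ m !
  Π-factorial zero    = refl
  Π-factorial (suc m) = begin
    Π suc (suc m)   ≡⟨ Π-snoc suc m ⟩
    Π suc m * suc m ≡⟨ cong (_* suc m) (Π-factorial m) ⟩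
    m ! * suc m     ≡⟨ *-comm (m !) (suc m) ⟩
    suc m !         ∎

  !-double : ∀ m → (m + m) ! ≡ Π (λ i → suc (i + i)) m * (2 ^ m * m !)
  !-double m = begin
    (m + m) !                                               ≡⟨ Π-factorial (m + m) ⟨
    Π suc (m + m)                                           ≡⟨ Π-evenodd suc m ⟩
    Π odd m * Π (λ i → suc (suc (i + i))) m                 ≡⟨ cong (Π odd m *_) (Π-ext m double) ⟩
    Π odd m * Π (λ i → 2 * suc i) m                         ≡⟨ cong (Π odd m *_) (Π-scale 2 suc m) ⟩
    Π odd m * (2 ^ m * Π suc m)                             ≡⟨ cong (λ z → Π odd m * (2 ^ m * z)) (Π-factorial m) ⟩
    Π odd m * (2 ^ m * m !)                                 ∎
    where
    odd : ℕ → ℕ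
    odd i = suc (i + i)
    double : ∀ i → suc (suc (i + i)) ≡ 2 * suc i
    double = solve-∀

  product-applyUpTo : ∀ {A : Set} (g : A → ℕ) s m → product (map g (applyUpTo s m)) ≡ Π (g ∘ s) m
  product-applyUpTo g s zero    = refl
  product-applyUpTo g s (suc m) = cong (g (s 0) *_) (product-applyUpTo g (s ∘ suc) m)

  product-map-* : ∀ {A : Set} (f g : A → ℕ) L →
                  product (map (λ z → f z * g z) L) ≡ product (map f L) * product (map g L)
  product-map-* f g []      = refl
  product-map-* f g (z ∷ L) = trans (cong (f z * g z *_) (product-map-* f g L)) (interchange (f z) (g z) _ _)

  product-map-1 : ∀ {A : Set} (L : List A) → product (map (λ _ → 1) L) ≡ 1
  product-map-1 []      = refl
  product-map-1 (z ∷ L) = trans (+-identityʳ _) (product-map-1 L)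

module Congruences where

  open import Data.Nat using (ℕ; suc; zero; _+_; _*_; _∸_; _<_; z<s; s<s)
  open import Data.Nat.Tactic.RingSolver using (solve-∀)
  open import Data.Integer as ℤ using (+_)
  import Data.Integer.Properties as ℤ
  import Data.Integer.Tactic.RingSolver as ℤ-Solver
  open import Data.Integer.Divisibility.Signed using (_∣_; divides; ∣m∣n⇒∣m+n; ∣m⇒∣-m; ∣m⇒∣m*n; ∣n⇒∣m*n)
  open import Relation.Binary.Bundles using (Setoid)
  import Relation.Binary.Reasoning.Setoid as SetoidReasoning
  open import Relation.Binary.PropositionalEquality
  open ≡-Reasoning
  open RangeProducts using (Π; Π-zip-reverse)

  infix 4 _≡_⟨mod_⟩

  record _≡_⟨mod_⟩ (a b m : ℕ) : Set where
    constructor divides-difference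
    field difference : + m ∣ + a ℤ.- + b
  open _≡_⟨mod_⟩ public

  ≡mod-intro : ∀ {m a b} x y → a + x * m ≡ b + y * m → a ≡ b ⟨mod m ⟩
  ≡mod-intro {m} {a} {b} x y eq = divides-difference (divides (+ y ℤ.- + x) (begin
    + a ℤ.- + b
      ≡⟨ rearrange (+ a) (+ b) (+ x) (+ y) (+ m) ⟩
    (+ a ℤ.+ + x ℤ.* + m) ℤ.- (+ b ℤ.+ + y ℤ.* + m) ℤ.+ (+ y ℤ.- + x) ℤ.* + m
      ≡⟨ cong (ℤ._+ (+ y ℤ.- + x) ℤ.* + m) (ℤ.i≡j⇒i-j≡0 cast) ⟩
    ℤ.0ℤ ℤ.+ (+ y ℤ.- + x) ℤ.* + m
      ≡⟨ ℤ.+-identityˡ _ ⟩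
    (+ y ℤ.- + x) ℤ.* + m ∎))
    where
    rearrange : ∀ a b x y m → a ℤ.- b ≡ (a ℤ.+ x ℤ.* m) ℤ.- (b ℤ.+ y ℤ.* m) ℤ.+ (y ℤ.- x) ℤ.* m
    rearrange = ℤ-Solver.solve-∀
    cast : + a ℤ.+ + x ℤ.* + m ≡ + b ℤ.+ + y ℤ.* + m
    cast = begin
      + a ℤ.+ + x ℤ.* + m ≡⟨ cong (λ z → + a ℤ.+ z) (ℤ.pos-* x m) ⟨
      + (a + x * m)       ≡⟨ cong +_ eq ⟩
      + (b + y * m)       ≡⟨ cong (λ z → + b ℤ.+ z) (ℤ.pos-* y m) ⟩
      + b ℤ.+ + y ℤ.* + m ∎

  ≡mod-refl : ∀ {m} a → a ≡ a ⟨mod m ⟩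
  ≡mod-refl a = ≡mod-intro {a = a} 0 0 refl

  ≡mod-reflexive : ∀ {m a b} → a ≡ b → a ≡ b ⟨mod m ⟩
  ≡mod-reflexive refl = ≡mod-refl _

  ≡mod-sym : ∀ {m a b} → a ≡ b ⟨mod m ⟩ → b ≡ a ⟨mod m ⟩
  ≡mod-sym {m} {a} {b} (divides-difference ab) =
    divides-difference (subst (+ m ∣_) (flip (+ a) (+ b)) (∣m⇒∣-m ab))
    where flip : ∀ a b → ℤ.- (a ℤ.- b) ≡ b ℤ.- a
          flip = ℤ-Solver.solve-∀

  ≡mod-trans : ∀ {m a b c} → a ≡ b ⟨mod m ⟩ → b ≡ c ⟨mod m ⟩ → a ≡ c ⟨mod m ⟩
  ≡mod-trans {m} {a} {b} {c} (divides-difference ab) (divides-difference bc) =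
    divides-difference (subst (+ m ∣_) (telescope (+ a) (+ b) (+ c)) (∣m∣n⇒∣m+n ab bc))
    where telescope : ∀ a b c → (a ℤ.- b) ℤ.+ (b ℤ.- c) ≡ a ℤ.- c
          telescope = ℤ-Solver.solve-∀

  ≡mod-* : ∀ {m a b c d} → a ≡ b ⟨mod m ⟩ → c ≡ d ⟨mod m ⟩ → a * c ≡ b * d ⟨mod m ⟩
  ≡mod-* {m} {a} {b} {c} {d} (divides-difference ab) (divides-difference cd) =
    divides-difference (subst (+ m ∣_) (sym split) (∣m∣n⇒∣m+n (∣m⇒∣m*n (+ c) ab) (∣n⇒∣m*n (+ b) cd)))
    where
    expand : ∀ a b c d → a ℤ.* c ℤ.- b ℤ.* d ≡ (a ℤ.- b) ℤ.* c ℤ.+ b ℤ.* (c ℤ.- d)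
    expand = ℤ-Solver.solve-∀
    split : + (a * c) ℤ.- + (b * d) ≡ (+ a ℤ.- + b) ℤ.* + c ℤ.+ + b ℤ.* (+ c ℤ.- + d)
    split = trans (cong₂ ℤ._-_ (ℤ.pos-* a c) (ℤ.pos-* b d)) (expand (+ a) (+ b) (+ c) (+ d))

  Π-≡mod : ∀ {M f g} m → (∀ i → i < m → f i ≡ g i ⟨mod M ⟩) → Π f m ≡ Π g m ⟨mod M ⟩
  Π-≡mod zero    eq = ≡mod-refl 1
  Π-≡mod (suc m) eq = ≡mod-* (eq 0 z<s) (Π-≡mod m (λ i i<m → eq (suc i) (s<s i<m)))

  Π-zip-≡mod : ∀ {M} f g f′ g′ m → (∀ i → i < m → f i * g (m ∸ suc i) ≡ f′ i * g′ (m ∸ suc i) ⟨mod M ⟩) →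
               Π f m * Π g m ≡ Π f′ m * Π g′ m ⟨mod M ⟩
  Π-zip-≡mod f g f′ g′ m pairs =
    subst₂ (_≡_⟨mod _ ⟩) (sym (Π-zip-reverse f g m)) (sym (Π-zip-reverse f′ g′ m)) (Π-≡mod m pairs)

  shifted-pair : ∀ {P} x y t c → x + y ≡ c * P → (x + t * P) * (y + t * P) ≡ x * y ⟨mod P * P ⟩
  shifted-pair {P} x y t c sum = ≡mod-intro 0 (t * c + t * t) (begin
    (x + t * P) * (y + t * P) + 0 * (P * P)        ≡⟨ expand x y t P ⟩
    x * y + t * P * (x + y) + t * t * (P * P)      ≡⟨ cong (λ z → x * y + t * P * z + t * t * (P * P)) sum ⟩
    x * y + t * P * (c * P) + t * t * (P * P)      ≡⟨ collect x y t P c ⟩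
    x * y + (t * c + t * t) * (P * P)              ∎)
    where
    expand : ∀ x y t P → (x + t * P) * (y + t * P) + 0 * (P * P) ≡ x * y + t * P * (x + y) + t * t * (P * P)
    expand = solve-∀
    collect : ∀ x y t P c → x * y + t * P * (c * P) + t * t * (P * P) ≡ x * y + (t * c + t * t) * (P * P)
    collect = solve-∀

  reflected-pair : ∀ {P} x y u v s c → x + u ≡ s * P → y + v ≡ s * P → x + y ≡ c * P →
                   u * v ≡ x * y ⟨mod P * P ⟩
  reflected-pair {P} x y u v s c xu yv sum = ≡mod-intro (s * c) (s * s) (begin
    u * v + s * c * (P * P)          ≡⟨ regroup u v s c P ⟩
    u * v + s * P * (c * P)          ≡⟨ cong (λ z → u * v + s * P * z) sum ⟨
    u * v + s * P * (x + y)          ≡⟨ distribute u v s P x y ⟩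
    u * v + s * P * x + s * P * y    ≡⟨ cong₂ (λ a b → u * v + a * x + b * y) yv xu ⟨
    u * v + (y + v) * x + (x + u) * y ≡⟨ factor x y u v ⟩
    x * y + (x + u) * (y + v)        ≡⟨ cong₂ (λ a b → x * y + a * b) xu yv ⟩
    x * y + s * P * (s * P)          ≡⟨ regroup′ x y s P ⟩
    x * y + s * s * (P * P)          ∎)
    where
    regroup : ∀ u v s c P → u * v + s * c * (P * P) ≡ u * v + s * P * (c * P)
    regroup = solve-∀
    distribute : ∀ u v s P x y → u * v + s * P * (x + y) ≡ u * v + s * P * x + s * P * y
    distribute = solve-∀
    factor : ∀ x y u v → u * v + (y + v) * x + (x + u) * y ≡ x * y + (x + u) * (y + v)
    factor = solve-∀
    regroup′ : ∀ x y s P → x * y + s * P * (s * P) ≡ x * y + s * s * (P * P)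
    regroup′ = solve-∀

  ≡mod-setoid : ℕ → Setoid _ _
  ≡mod-setoid m = record
    { Carrier       = ℕ
    ; _≈_           = _≡_⟨mod m ⟩
    ; isEquivalence = record { refl = ≡mod-refl _ ; sym = ≡mod-sym ; trans = ≡mod-trans }
    }

  module ≡mod-Reasoning (m : ℕ) = SetoidReasoning (≡mod-setoid m)

module OmittedProducts where

  open import Data.Nat
  open import Data.Nat.Properties
  open import Data.Nat.Tactic.RingSolver using (solve-∀; solve)
  open import Data.List using ([]; _∷_; map; filter)
  open import Data.List.Properties using (filter-accept; filter-reject)
  open import Data.Nat.ListAction using (product)
  open import Function using (_∘_)
  open import Relation.Nullary using (Dec; yes; no; contradiction)
  open import Relation.Nullary.Decidable using (¬?)
  open import Relation.Binary.PropositionalEquality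
  open ≡-Reasoning
  open RangeProducts
  open Congruences

  knock-out : ℕ → (ℕ → ℕ) → ℕ → ℕ
  knock-out key u j with j ≟ key
  ... | yes _ = 1
  ... | no  _ = u j

  knock-out-key : ∀ key u → knock-out key u key ≡ 1
  knock-out-key key u with key ≟ key
  ... | yes _      = refl
  ... | no key≢key = contradiction refl key≢key

  knock-out-other : ∀ key u j → j ≢ key → knock-out key u j ≡ u j
  knock-out-other key u j j≢key with j ≟ key
  ... | yes j≡key = contradiction j≡key j≢key
  ... | no  _     = refl

  product-filter : ∀ key u L → product (map u (filter (λ j → ¬? (j ≟ key)) L)) ≡ product (map (knock-out key u) L)
  product-filter key u []      = refl
  product-filter key u (j ∷ L) = by-cases (j ≟ key)
    where
    keep? = λ i → ¬? (i ≟ key)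
    rest  = product (map (knock-out key u) L)
    by-cases : Dec (j ≡ key) → product (map u (filter keep? (j ∷ L))) ≡ knock-out key u j * rest
    by-cases (yes refl) = begin
      product (map u (filter keep? (j ∷ L)))  ≡⟨ cong (product ∘ map u) (filter-reject keep? (λ j≢j → j≢j refl)) ⟩
      product (map u (filter keep? L))        ≡⟨ product-filter key u L ⟩
      rest                                    ≡⟨ *-identityˡ rest ⟨
      1 * rest                                ≡⟨ cong (_* rest) (knock-out-key j u) ⟨
      knock-out key u j * rest                ∎
    by-cases (no j≢key) = begin
      product (map u (filter keep? (j ∷ L)))  ≡⟨ cong (product ∘ map u) (filter-accept keep? j≢key) ⟩
      u j * product (map u (filter keep? L))  ≡⟨ cong₂ _*_ (knock-out-other key u j j≢key) (sym (product-filter key u L)) ⟨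
      knock-out key u j * rest                ∎

  -- Π-omit k u = ∏_{j ≤ 4k, j ≠ k} u j, grouped into the four blocks
  -- [0, k), k+1+[0, k), 2k+1+[0, k) and 3k+1+[0, k).
  Π-omit : ℕ → (ℕ → ℕ) → ℕ
  Π-omit k u = (Π u k * Π (λ i → u (suc k + i)) k)
             * (Π (λ i → u (suc k + (k + i))) k * Π (λ i → u (suc k + (k + (k + i)))) k)

  Π-remove : ∀ k u → Π u (suc (k * 4)) ≡ u k * Π-omit k u
  Π-remove k u = begin
    Π u (suc (k * 4))
      ≡⟨ cong (Π u) (layout k) ⟩
    Π u (k + suc (k + (k + k)))
      ≡⟨ Π-split u k _ ⟩
    A * (u (k + 0) * Π (λ i → u (k + suc i)) (k + (k + k)))
      ≡⟨ cong₂ (λ x y → A * (u x * y)) (+-identityʳ k) (Π-ext (k + (k + k)) (λ i → cong u (+-suc k i))) ⟩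
    A * (u k * Π (λ i → u (suc k + i)) (k + (k + k)))
      ≡⟨ cong (λ z → A * (u k * z)) (Π-split (λ i → u (suc k + i)) k (k + k)) ⟩
    A * (u k * (B * Π (λ i → u (suc k + (k + i))) (k + k)))
      ≡⟨ cong (λ z → A * (u k * (B * z))) (Π-split (λ i → u (suc k + (k + i))) k k) ⟩
    A * (u k * (B * (C * D)))
      ≡⟨ regroup A (u k) B C D ⟩
    u k * Π-omit k u ∎
    where
    A = Π u k
    B = Π (λ i → u (suc k + i)) k
    C = Π (λ i → u (suc k + (k + i))) k
    D = Π (λ i → u (suc k + (k + (k + i)))) k
    layout : ∀ k → suc (k * 4) ≡ k + suc (k + (k + k))
    layout = solve-∀
    regroup : ∀ a x b c d → a * (x * (b * (c * d))) ≡ x * ((a * b) * (c * d))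
    regroup = solve-∀

  Π-omit-cong : ∀ k {u v} → (∀ j → j ≢ k → u j ≡ v j) → Π-omit k u ≡ Π-omit k v
  Π-omit-cong k eq = cong₂ _*_
    (cong₂ _*_ (Π-cong k (λ i i<k → eq i (<⇒≢ i<k))) (Π-ext k (λ i → eq _ above)))
    (cong₂ _*_ (Π-ext k (λ i → eq _ above)) (Π-ext k (λ i → eq _ above)))
    where above : ∀ {n} → suc k + n ≢ k
          above e = m≢1+m+n k (sym e)

  record IsPair (k a b : ℕ) : Set where
    field
      fst≤     : a ≤ k * 4
      snd≤     : b ≤ k * 4
      multiple : ℕ
      sum      : 1 + 4 * a + (1 + 4 * b) ≡ multiple * suc (k * 4)

  ≤-of-sum : ∀ {a n} d → a + d ≡ n → a ≤ n
  ≤-of-sum {a} d eq = subst (a ≤_) eq (m≤m+n a d)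

  -- The blocks of Π-omit pair up: i with 2k - i, and 2k + 1 + i with 4k - i.
  -- Here k = i + 1 + r, i.e. r = k - 1 - i.
  first-pair : ∀ {k} i r → suc i + r ≡ k → IsPair k i (suc k + r)
  first-pair i r refl = record
    { fst≤     = ≤-of-sum (3 * i + 4 * r + 4) (solve (i ∷ r ∷ []))
    ; snd≤     = ≤-of-sum (3 * i + 2 * r + 2) (solve (i ∷ r ∷ []))
    ; multiple = 2
    ; sum      = solve (i ∷ r ∷ [])
    }

  second-pair : ∀ {k} i r → suc i + r ≡ k → IsPair k (suc k + (k + i)) (suc k + (k + (k + r)))
  second-pair i r refl = record
    { fst≤     = ≤-of-sum (i + 2 * r + 1) (solve (i ∷ r ∷ []))
    ; snd≤     = ≤-of-sum i (solve (i ∷ r ∷ []))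
    ; multiple = 6
    ; sum      = solve (i ∷ r ∷ [])
    }

  Π-omit-≡mod : ∀ {M} k u v → (∀ {a b} → IsPair k a b → u a * u b ≡ v a * v b ⟨mod M ⟩) →
                Π-omit k u ≡ Π-omit k v ⟨mod M ⟩
  Π-omit-≡mod k u v pairs = ≡mod-*
    (Π-zip-≡mod u (second u) v (second v) k
                (λ i i<k → pairs (first-pair i (k ∸ suc i) (m+[n∸m]≡n i<k))))
    (Π-zip-≡mod (third u) (fourth u) (third v) (fourth v) k
                (λ i i<k → pairs (second-pair i (k ∸ suc i) (m+[n∸m]≡n i<k))))
    where
    second third fourth : (ℕ → ℕ) → ℕ → ℕ
    second f i = f (suc k + i)
    third  f i = f (suc k + (k + i))
    fourth f i = f (suc k + (k + (k + i)))

module PrimeDivisibility where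

  open import Data.Nat
  open import Data.Nat.Tactic.RingSolver using (solve-∀)
  open import Data.Nat.Divisibility using (_∣_; divides; ∣1⇒≡1; m*n∣⇒m∣; *-cancelʳ-∣; *-monoˡ-∣)
  open import Data.Nat.Primality using (euclidsLemma; prime⇒nonZero; ¬prime[1])
  open import Data.Sum using ([_,_])
  open import Function using (_∘_; id)
  open import Relation.Nullary using (¬_; contradiction)
  open import Relation.Binary.PropositionalEquality
  open RangeProducts using (Π)

  prime∤1 : ∀ {p} → Prime p → ¬ p ∣ 1
  prime∤1 p-prime p∣1 = ¬prime[1] (subst Prime (∣1⇒≡1 p∣1) p-prime)

  prime∤Π : ∀ {p} f m → Prime p → (∀ i → i < m → ¬ p ∣ f i) → ¬ p ∣ Π f m
  prime∤Π f zero    p-prime _ = prime∤1 p-prime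
  prime∤Π f (suc m) p-prime p∤f p∣Π =
    [ p∤f 0 z<s , prime∤Π (f ∘ suc) m p-prime (λ i i<m → p∤f (suc i) (s<s i<m)) ] (euclidsLemma (f 0) _ p-prime p∣Π)

  prime-cancel : ∀ {p m c} → Prime p → ¬ p ∣ c → p ∣ m * c → p ∣ m
  prime-cancel {m = m} {c} p-prime p∤c p∣mc =
    [ id , (λ p∣c → contradiction p∣c p∤c) ] (euclidsLemma m c p-prime p∣mc)

  -- Writing m = q p, p² ∣ q p c gives p ∣ q c and hence p ∣ q.
  square-cancel : ∀ {p m c} → Prime p → ¬ p ∣ c → p * p ∣ m * c → p * p ∣ m
  square-cancel {p} {m} {c} p-prime p∤c p²∣mc with prime-cancel {m = m} p-prime p∤c (m*n∣⇒m∣ p p p²∣mc)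
  ... | divides q refl = *-monoˡ-∣ p p∣q
    where
    instance _ = prime⇒nonZero p-prime
    swap : ∀ q p c → q * p * c ≡ q * c * p
    swap = solve-∀
    p∣q : p ∣ q
    p∣q = prime-cancel p-prime p∤c (*-cancelʳ-∣ p (subst (p * p ∣_) (swap q p c) p²∣mc))

module Fractions where

  open import Data.Nat as ℕ using (ℕ; suc)
  import Data.Nat.Properties as ℕ
  open import Data.Nat.Divisibility using (_∣_)
  open import Data.Nat.Primality using (euclidsLemma)
  open import Data.Integer as ℤ using (ℤ; +_)
  import Data.Integer.Properties as ℤ
  open import Data.Integer.Tactic.RingSolver using (solve-∀)
  open import Data.Integer.Divisibility.Signed as ℤ∣ using (∣⇒∣ᵤ)
  open import Data.Rational as ℚ using (ℚ; toℚᵘ)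
  import Data.Rational.Properties as ℚ
  open import Data.Rational.Unnormalised as ℚᵘ using (ℚᵘ; mkℚᵘ; *≡*)
  import Data.Rational.Unnormalised.Properties as ℚᵘ
  open import Data.List using ([]; _∷_; map)
  open import Data.Nat.ListAction using (product)
  open import Data.Sum using ([_,_])
  open import Relation.Nullary using (¬_)
  open import Relation.Binary.PropositionalEquality
  open ≡-Reasoning
  open Congruences
  open PrimeDivisibility using (square-cancel)

  infix 4 _≈_⟋_

  record _≈_⟋_ (u : ℚᵘ) (a : ℤ) (b : ℕ) : Set where
    constructor cross
    field cross-eq : ℚᵘ.↥ u ℤ.* + b ≡ a ℤ.* ℚᵘ.↧ u
  open _≈_⟋_ public

  ≈-resp-≃ : ∀ {u v a b} → u ℚᵘ.≃ v → v ≈ a ⟋ b → u ≈ a ⟋ b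
  ≈-resp-≃ {mkℚᵘ m e} {mkℚᵘ n f} {a} {b} (*≡* uv) (cross hv) = cross (ℤ.*-cancelʳ-≡ _ _ (+ suc f) (begin
    m ℤ.* + b ℤ.* + suc f   ≡⟨ swap m (+ b) (+ suc f) ⟩
    m ℤ.* + suc f ℤ.* + b   ≡⟨ cong (ℤ._* + b) uv ⟩
    n ℤ.* + suc e ℤ.* + b   ≡⟨ swap n (+ suc e) (+ b) ⟩
    n ℤ.* + b ℤ.* + suc e   ≡⟨ cong (ℤ._* + suc e) hv ⟩
    a ℤ.* + suc f ℤ.* + suc e ≡⟨ swap a (+ suc f) (+ suc e) ⟩
    a ℤ.* + suc e ℤ.* + suc f ∎))
    where swap : ∀ x y z → x ℤ.* y ℤ.* z ≡ x ℤ.* z ℤ.* y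
          swap = solve-∀

  ≈-* : ∀ {u v a b c d} → u ≈ a ⟋ b → v ≈ c ⟋ d → u ℚᵘ.* v ≈ a ℤ.* c ⟋ b ℕ.* d
  ≈-* {mkℚᵘ m e} {mkℚᵘ n f} {a} {b} {c} {d} (cross hu) (cross hv) = cross (begin
    m ℤ.* n ℤ.* + (b ℕ.* d)                  ≡⟨ cong (m ℤ.* n ℤ.*_) (ℤ.pos-* b d) ⟩
    m ℤ.* n ℤ.* (+ b ℤ.* + d)                ≡⟨ interchange m n (+ b) (+ d) ⟩
    (m ℤ.* + b) ℤ.* (n ℤ.* + d)              ≡⟨ cong₂ ℤ._*_ hu hv ⟩
    (a ℤ.* + suc e) ℤ.* (c ℤ.* + suc f)      ≡⟨ interchange a (+ suc e) c (+ suc f) ⟩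
    a ℤ.* c ℤ.* (+ suc e ℤ.* + suc f)        ≡⟨ cong (a ℤ.* c ℤ.*_) (ℤ.pos-* (suc e) (suc f)) ⟨
    a ℤ.* c ℤ.* + (suc e ℕ.* suc f)          ∎)
    where interchange : ∀ w x y z → w ℤ.* x ℤ.* (y ℤ.* z) ≡ (w ℤ.* y) ℤ.* (x ℤ.* z)
          interchange = solve-∀

  ≈-- : ∀ {u v a b c d} → u ≈ a ⟋ b → v ≈ c ⟋ d → u ℚᵘ.- v ≈ a ℤ.* + d ℤ.- c ℤ.* + b ⟋ b ℕ.* d
  ≈-- {mkℚᵘ m e} {mkℚᵘ n f} {a} {b} {c} {d} (cross hu) (cross hv) = cross (begin
    (m ℤ.* + suc f ℤ.+ ℤ.- n ℤ.* + suc e) ℤ.* + (b ℕ.* d)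
      ≡⟨ cong ((m ℤ.* + suc f ℤ.+ ℤ.- n ℤ.* + suc e) ℤ.*_) (ℤ.pos-* b d) ⟩
    (m ℤ.* + suc f ℤ.+ ℤ.- n ℤ.* + suc e) ℤ.* (+ b ℤ.* + d)
      ≡⟨ regroup m n (+ suc e) (+ suc f) (+ b) (+ d) ⟩
    (m ℤ.* + b) ℤ.* (+ suc f ℤ.* + d) ℤ.- (n ℤ.* + d) ℤ.* (+ suc e ℤ.* + b)
      ≡⟨ cong₂ (λ x y → x ℤ.* (+ suc f ℤ.* + d) ℤ.- y ℤ.* (+ suc e ℤ.* + b)) hu hv ⟩
    (a ℤ.* + suc e) ℤ.* (+ suc f ℤ.* + d) ℤ.- (c ℤ.* + suc f) ℤ.* (+ suc e ℤ.* + b)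
      ≡⟨ regroup′ a c (+ suc e) (+ suc f) (+ b) (+ d) ⟩
    (a ℤ.* + d ℤ.- c ℤ.* + b) ℤ.* (+ suc e ℤ.* + suc f)
      ≡⟨ cong ((a ℤ.* + d ℤ.- c ℤ.* + b) ℤ.*_) (ℤ.pos-* (suc e) (suc f)) ⟨
    (a ℤ.* + d ℤ.- c ℤ.* + b) ℤ.* + (suc e ℕ.* suc f) ∎)
    where
    regroup : ∀ m n e f b d → (m ℤ.* f ℤ.+ ℤ.- n ℤ.* e) ℤ.* (b ℤ.* d)
                            ≡ (m ℤ.* b) ℤ.* (f ℤ.* d) ℤ.- (n ℤ.* d) ℤ.* (e ℤ.* b)
    regroup = solve-∀
    regroup′ : ∀ a c e f b d → (a ℤ.* e) ℤ.* (f ℤ.* d) ℤ.- (c ℤ.* f) ℤ.* (e ℤ.* b)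
                             ≡ (a ℤ.* d ℤ.- c ℤ.* b) ℤ.* (e ℤ.* f)
    regroup′ = solve-∀

  /-≈ : ∀ a b → toℚᵘ (+ a ℚ./ suc b) ≈ + a ⟋ suc b
  /-≈ a b = ≈-resp-≃ (ℚ.toℚᵘ-fromℚᵘ (mkℚᵘ (+ a) b)) (cross refl)

  ≈-*ℚ : ∀ {x y a b c d} → toℚᵘ x ≈ + a ⟋ b → toℚᵘ y ≈ + c ⟋ d →
         toℚᵘ (x ℚ.* y) ≈ + (a ℕ.* c) ⟋ b ℕ.* d
  ≈-*ℚ {x} {y} {a} {c = c} hx hy =
    ≈-resp-≃ (ℚ.toℚᵘ-homo-* x y) (subst (λ n → _ ≈ n ⟋ _) (sym (ℤ.pos-* a c)) (≈-* hx hy))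

  ≈-prodℚ : ∀ {A : Set} (f : A → ℚ) (num den : A → ℕ) → (∀ z → toℚᵘ (f z) ≈ + num z ⟋ den z) →
            ∀ L → toℚᵘ (prodℚ (map f L)) ≈ + product (map num L) ⟋ product (map den L)
  ≈-prodℚ f num den hf []      = /-≈ 1 0
  ≈-prodℚ f num den hf (z ∷ L) = ≈-*ℚ (hf z) (≈-prodℚ f num den hf L)

  ≈--ℚ : ∀ {x y a b c d} → toℚᵘ x ≈ a ⟋ b → toℚᵘ y ≈ c ⟋ d →
         toℚᵘ (x ℚ.- y) ≈ a ℤ.* + d ℤ.- c ℤ.* + b ⟋ b ℕ.* d
  ≈--ℚ {x} {y} hx hy = ≈-resp-≃ homo (≈-- hx hy)
    where homo = ℚᵘ.≃-trans (ℚ.toℚᵘ-homo-+ x (ℚ.- y)) (ℚᵘ.+-congʳ (toℚᵘ x) (ℚ.toℚᵘ-homo‿- y))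

  fractions-≡-mod : ∀ {p x y a b c d} → Prime p →
    toℚᵘ x ≈ + a ⟋ b → toℚᵘ y ≈ + c ⟋ d → a ≡ b ⟨mod p ℕ.* p ⟩ → c ≡ d ⟨mod p ℕ.* p ⟩ →
    ¬ p ∣ b → ¬ p ∣ d → x ≡ y [mod p ℕ.^ 2 ]
  fractions-≡-mod {p} {x} {y} {a} {b} {c} {d} p-prime hx hy a≡b c≡d p∤b p∤d =
    subst (_∣ ℤ.∣ ℚ.↥ (x ℚ.- y) ∣) (cong (p ℕ.*_) (sym (ℕ.*-identityʳ p)))
      (square-cancel p-prime p∤bd p²∣num*bd)
    where
    p∤bd : ¬ p ∣ b ℕ.* d
    p∤bd p∣bd = [ p∤b , p∤d ] (euclidsLemma b d p-prime p∣bd)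
    ad≡cb : a ℕ.* d ≡ c ℕ.* b ⟨mod p ℕ.* p ⟩
    -- a d ≡ b d = d b ≡ c b
    ad≡cb = ≡mod-trans (≡mod-* a≡b (≡mod-refl d))
              (≡mod-trans (≡mod-reflexive (ℕ.*-comm b d)) (≡mod-sym (≡mod-* c≡d (≡mod-refl b))))
    numerator-eq : ℚ.↥ (x ℚ.- y) ℤ.* + (b ℕ.* d) ≡ (+ a ℤ.* + d ℤ.- + c ℤ.* + b) ℤ.* ℚ.↧ (x ℚ.- y)
    numerator-eq = subst₂ (λ n q → n ℤ.* + (b ℕ.* d) ≡ (+ a ℤ.* + d ℤ.- + c ℤ.* + b) ℤ.* q)
                     (ℚ.↥ᵘ-toℚᵘ (x ℚ.- y)) (ℚ.↧ᵘ-toℚᵘ (x ℚ.- y)) (cross-eq (≈--ℚ hx hy))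
    p²∣difference : + (p ℕ.* p) ℤ∣.∣ + a ℤ.* + d ℤ.- + c ℤ.* + b
    p²∣difference = subst (+ (p ℕ.* p) ℤ∣.∣_) (cong₂ ℤ._-_ (ℤ.pos-* a d) (ℤ.pos-* c b)) (difference ad≡cb)
    p²∣num*bd : p ℕ.* p ∣ ℤ.∣ ℚ.↥ (x ℚ.- y) ∣ ℕ.* (b ℕ.* d)
    p²∣num*bd = subst (p ℕ.* p ∣_) (ℤ.abs-* (ℚ.↥ (x ℚ.- y)) (+ (b ℕ.* d)))
                  (∣⇒∣ᵤ (subst (+ (p ℕ.* p) ℤ∣.∣_) (sym numerator-eq) (ℤ∣.∣m⇒∣m*n _ p²∣difference)))

module Specialisation where

  open import Data.Nat
  open import Data.Nat.Properties
  open import Data.Nat.Tactic.RingSolver using (solve-∀)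
  open import Data.Nat.Divisibility using (_∣_; ∣m+n∣m⇒∣n; n∣m*n; ∣⇒≤)
  open import Data.Nat.Primality using (euclidsLemma)
  open import Data.Nat.DivMod using (m*n/n≡m)
  open import Data.Nat.ListAction using (product)
  open import Data.List using (map; filter; upTo)
  open import Data.Integer using (+_)
  open import Data.Rational using (toℚᵘ)
  open import Data.Product using (_,_)
  open import Data.Sum using ([_,_])
  open import Relation.Nullary using (¬_)
  open import Relation.Nullary.Decidable using (¬?)
  open import Relation.Binary.PropositionalEquality using (refl; sym; trans; cong; cong₂; subst; subst₂; module ≡-Reasoning)
  open RangeProducts
  open Congruences
  open OmittedProducts
  open PrimeDivisibility using (prime∤1; prime∤Π)
  open Fractions

  Claim : ℕ → Set
  Claim p = ((n : ℕ) → n ≥ 1 → F p n ≡ F p 0 [mod p ^ 2 ]) × (F p 0 ≡ 1ℚ [mod p ^ 2 ])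

  module Setting (k : ℕ) where

    P : ℕ
    P = suc (k * 4)

    g₀ : ℕ → ℕ
    g₀ j = 1 + 4 * j

    g : ℕ → ℕ → ℕ
    g n j = g₀ j + 4 * n * P

    h : ℕ → ℕ → ℕ
    h n i = suc (i + n * P)

    N D : ℕ → ℕ
    N n = Π-omit k (g n)
    D n = Π (h n) (k * 4)

    -- the reflected factors w j = 4P - (1 + 4j), which are the numbers ≡ 3 (mod 4) below 4P
    w : ℕ → ℕ
    w j = 3 + 4 * (k * 4 ∸ j)

    Ñ W : ℕ
    Ñ = Π-omit k g₀
    W = Π-omit k w

    -- Shifting n does not change N(n) modulo P², since its factors pair up.
    N≡Ñ : ∀ n → N n ≡ Ñ ⟨mod P * P ⟩
    N≡Ñ n = Π-omit-≡mod k (g n) g₀ (λ {a} {b} pair → let open IsPair pair in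
      shifted-pair (g₀ a) (g₀ b) (4 * n) multiple sum)

    reflect : ∀ {j} → j ≤ k * 4 → g₀ j + w j ≡ 4 * P
    reflect {j} j≤4k = begin
      1 + 4 * j + (3 + 4 * (k * 4 ∸ j))   ≡⟨ regroup j (k * 4 ∸ j) ⟩
      4 + 4 * (j + (k * 4 ∸ j))           ≡⟨ cong (λ z → 4 + 4 * z) (m+[n∸m]≡n j≤4k) ⟩
      4 + 4 * (k * 4)                     ≡⟨ times-four k ⟩
      4 * P                               ∎
      where open ≡-Reasoning
            regroup : ∀ j r → 1 + 4 * j + (3 + 4 * r) ≡ 4 + 4 * (j + r)
            regroup = solve-∀
            times-four : ∀ k → 4 + 4 * (k * 4) ≡ 4 * suc (k * 4)
            times-four = solve-∀

    -- Reflecting the factors about 2P does not change Ñ modulo P², since they pair up.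
    W≡Ñ : W ≡ Ñ ⟨mod P * P ⟩
    W≡Ñ = Π-omit-≡mod k w g₀ (λ {a} {b} pair → let open IsPair pair in
      reflected-pair (g₀ a) (g₀ b) (w a) (w b) 4 multiple (reflect fst≤) (reflect snd≤) sum)

    -- Shifting n does not change D(n) modulo P²: pair i with 4k - 1 - i.
    D≡factorial : ∀ n → D n ≡ (k * 4) ! ⟨mod P * P ⟩
    D≡factorial n = subst₂ (_≡_⟨mod P * P ⟩) (sym (folded (h n))) (trans (sym (folded suc)) (Π-factorial (k * 4)))
              (Π-≡mod m (λ i i<m → shifted-pair (suc i) (suc (m + (m ∸ suc i))) n 1 (pair-sum i<m)))
      where
      m = k + k
      folded : ∀ f → Π f (k * 4) ≡ Π (λ i → f i * f (m + (m ∸ suc i))) m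
      folded f = trans (cong (Π f) (quarters k)) (Π-halves f m)
        where quarters : ∀ k → k * 4 ≡ (k + k) + (k + k)
              quarters = solve-∀
      pair-sum : ∀ {i} → i < m → suc i + suc (m + (m ∸ suc i)) ≡ 1 * P
      pair-sum {i} i<m = begin
        suc i + suc (m + (m ∸ suc i))  ≡⟨ swap i m (m ∸ suc i) ⟩
        suc (m + (suc i + (m ∸ suc i))) ≡⟨ cong (λ z → suc (m + z)) (m+[n∸m]≡n i<m) ⟩
        suc (m + m)                     ≡⟨ halves k ⟩
        1 * P                           ∎
        where open ≡-Reasoning
              swap : ∀ i m r → suc i + suc (m + r) ≡ suc (m + (suc i + r))
              swap = solve-∀
              halves : ∀ k → suc ((k + k) + (k + k)) ≡ 1 * suc (k * 4)
              halves = solve-∀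

    -- (a + P)! = a! · D(t) · (a + P) for a = tP: the block a + [1, P) gives D(t).
    !-block : ∀ t → (t * P + P) ! ≡ (t * P) ! * (D t * (t * P + P))
    !-block t = begin
      (a + P) !                                                ≡⟨ Π-factorial (a + P) ⟨
      Π suc (a + P)                                            ≡⟨ Π-split suc a P ⟩
      Π suc a * Π (λ i → suc (a + i)) (suc (k * 4))            ≡⟨ cong₂ _*_ (Π-factorial a) (Π-snoc _ (k * 4)) ⟩
      a ! * (Π (λ i → suc (a + i)) (k * 4) * suc (a + k * 4))  ≡⟨ cong₂ (λ x y → a ! * (x * y)) block last ⟩
      a ! * (D t * (a + P))                                    ∎
      where
      open ≡-Reasoning
      a = t * P
      block : Π (λ i → suc (a + i)) (k * 4) ≡ D t
      block = Π-ext (k * 4) (λ i → cong suc (+-comm a i))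
      last : suc (a + k * 4) ≡ a + P
      last = sym (+-suc a (k * 4))

    -- The odd numbers below 4P are the numbers 1 + 4j and 3 + 4j for j < P;
    -- apart from P and 3P they make up Ñ and W.
    odd-product : Π (λ i → suc (i + i)) (P + P) ≡ P * Ñ * (3 * P * W)
    odd-product = begin
      Π odd (P + P)                                             ≡⟨ Π-evenodd odd P ⟩
      Π (λ i → odd (i + i)) P * Π (λ i → odd (suc (i + i))) P   ≡⟨ cong₂ _*_ (Π-ext P one-mod-4) three-mod-4-reflected ⟩
      Π g₀ P * Π w P                                            ≡⟨ cong₂ _*_ (Π-remove k g₀) (Π-remove k w) ⟩
      g₀ k * Ñ * (w k * W)                                      ≡⟨ cong₂ (λ x y → x * Ñ * (y * W)) (g₀-k k) w-k ⟩
      P * Ñ * (3 * P * W)                                       ∎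
      where
      open ≡-Reasoning
      odd : ℕ → ℕ
      odd i = suc (i + i)
      one-mod-4 : ∀ i → suc ((i + i) + (i + i)) ≡ 1 + 4 * i
      one-mod-4 = solve-∀
      three-mod-4 : ∀ i → suc (suc (i + i) + suc (i + i)) ≡ 3 + 4 * i
      three-mod-4 = solve-∀
      three-mod-4-reflected : Π (λ i → odd (suc (i + i))) P ≡ Π w P
      three-mod-4-reflected = trans (Π-ext P three-mod-4) (Π-reverse (λ j → 3 + 4 * j) P)
      g₀-k : ∀ k → 1 + 4 * k ≡ suc (k * 4)
      g₀-k = solve-∀
      w-k : w k ≡ 3 * P
      w-k = begin
        3 + 4 * (k * 4 ∸ k)          ≡⟨ cong (λ z → 3 + 4 * (z ∸ k)) (split k) ⟩
        3 + 4 * (k + k * 3 ∸ k)      ≡⟨ cong (λ z → 3 + 4 * z) (m+n∸m≡n k (k * 3)) ⟩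
        3 + 4 * (k * 3)              ≡⟨ triple k ⟩
        3 * P                        ∎
        where split : ∀ k → k * 4 ≡ k + k * 3
              split = solve-∀
              triple : ∀ k → 3 + 4 * (k * 3) ≡ 3 * suc (k * 4)
              triple = solve-∀

    -- Computing (4P)! once through the blocks of length P and once through odd and even
    -- numbers gives D(2) D(3) = 4^(P-1) Ñ W exactly.
    D₂D₃-identity : D 2 * D 3 ≡ 4 ^ (k * 4) * (Ñ * W)
    D₂D₃-identity = *-cancelˡ-≡ _ _ (X * (12 * (P * P))) {{m*n≢0 X (12 * (P * P)) {{(2 * P) !≢0}}}} (begin
      X * (12 * (P * P)) * (D 2 * D 3)                   ≡⟨ regroup X P (D 2) (D 3) ⟩
      X * (D 2 * (2 * P + P)) * (D 3 * (3 * P + P))      ≡⟨ cong (_* (D 3 * (3 * P + P))) (!-block 2) ⟨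
      (2 * P + P) ! * (D 3 * (3 * P + P))                ≡⟨ cong (λ z → z ! * (D 3 * (3 * P + P))) (two-plus-one P) ⟩
      (3 * P) ! * (D 3 * (3 * P + P))                    ≡⟨ !-block 3 ⟨
      (3 * P + P) !                                      ≡⟨ cong _! (three-plus-one P) ⟩
      ((P + P) + (P + P)) !                              ≡⟨ !-double (P + P) ⟩
      Π (λ i → suc (i + i)) (P + P) * (2 ^ (P + P) * (P + P) !)
                                                         ≡⟨ cong₂ (λ x y → x * (y * (P + P) !)) odd-product (2^[m+m] P) ⟩
      P * Ñ * (3 * P * W) * (4 ^ P * (P + P) !)          ≡⟨ cong (λ z → P * Ñ * (3 * P * W) * (4 ^ P * z !)) (doubling P) ⟩
      P * Ñ * (3 * P * W) * (4 * 4 ^ (k * 4) * X)        ≡⟨ regroup′ X P Ñ W (4 ^ (k * 4)) ⟩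
      X * (12 * (P * P)) * (4 ^ (k * 4) * (Ñ * W))       ∎)
      where
      open ≡-Reasoning
      X = (2 * P) !
      regroup : ∀ X P a b → X * (12 * (P * P)) * (a * b) ≡ X * (a * (2 * P + P)) * (b * (3 * P + P))
      regroup = solve-∀
      regroup′ : ∀ X P n w q → P * n * (3 * P * w) * (4 * q * X) ≡ X * (12 * (P * P)) * (q * (n * w))
      regroup′ = solve-∀
      two-plus-one : ∀ P → 2 * P + P ≡ 3 * P
      two-plus-one = solve-∀
      three-plus-one : ∀ P → 3 * P + P ≡ (P + P) + (P + P)
      three-plus-one = solve-∀
      doubling : ∀ P → P + P ≡ 2 * P
      doubling = solve-∀
      2^[m+m] : ∀ m → 2 ^ (m + m) ≡ 4 ^ m
      2^[m+m] m = trans (cong (λ z → 2 ^ (m + z)) (sym (+-identityʳ m))) (sym (^-*-assoc 2 2 m))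

    numerator≡denominator : ∀ n → 4 ^ (k * 4) * (N n * N n) ≡ D n * D n ⟨mod P * P ⟩
    numerator≡denominator n = begin
      4 ^ (k * 4) * (N n * N n)   ≈⟨ ≡mod-* (≡mod-refl (4 ^ (k * 4))) (≡mod-* (N≡Ñ n) (N≡Ñ n)) ⟩
      4 ^ (k * 4) * (Ñ * Ñ)       ≈⟨ ≡mod-* (≡mod-refl (4 ^ (k * 4))) (≡mod-* (≡mod-refl Ñ) (≡mod-sym W≡Ñ)) ⟩
      4 ^ (k * 4) * (Ñ * W)       ≡⟨ D₂D₃-identity ⟨
      D 2 * D 3                   ≈⟨ ≡mod-* (D≡factorial 2) (D≡factorial 3) ⟩
      (k * 4) ! * (k * 4) !       ≈⟨ ≡mod-* (D≡factorial n) (D≡factorial n) ⟨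
      D n * D n                   ∎
      where open ≡mod-Reasoning (P * P)

    N-list : ∀ n → product (map (g n) (filter (λ j → ¬? (j ≟ (P ∸ 1) / 4)) (upTo P))) ≡ N n
    N-list n = begin
      product (map (g n) (filter (λ j → ¬? (j ≟ key)) (upTo P)))  ≡⟨ product-filter key (g n) (upTo P) ⟩
      product (map (knock-out key (g n)) (upTo P))                ≡⟨ product-applyUpTo (knock-out key (g n)) (λ j → j) P ⟩
      Π (knock-out key (g n)) P                                   ≡⟨ cong (λ z → Π (knock-out z (g n)) P) (m*n/n≡m k 4) ⟩
      Π (knock-out k (g n)) P                                     ≡⟨ Π-remove k (knock-out k (g n)) ⟩
      knock-out k (g n) k * Π-omit k (knock-out k (g n))
        ≡⟨ cong₂ _*_ (knock-out-key k (g n)) (Π-omit-cong k (knock-out-other k (g n))) ⟩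
      1 * N n                                                     ≡⟨ *-identityˡ (N n) ⟩
      N n                                                         ∎
      where open ≡-Reasoning
            key = (P ∸ 1) / 4

    F-fraction : ∀ n → toℚᵘ (F P n) ≈ + (4 ^ (k * 4) * (N n * N n)) ⟋ D n * D n
    F-fraction n = subst₂ (λ a b → toℚᵘ (F P n) ≈ + a ⟋ b) numerator denominator
      (≈-*ℚ (≈-*ℚ (/-≈ (4 ^ (k * 4)) 0)
                  (≈-prodℚ _ (λ j → g n j * g n j) (λ _ → 1) (λ j → ≈-*ℚ (/-≈ (g n j) 0) (/-≈ (g n j) 0)) L₁))
            (≈-prodℚ _ (λ _ → 1) (λ i → h n i * h n i) (λ i → ≈-*ℚ (/-≈ 1 (i + n * P)) (/-≈ 1 (i + n * P))) L₂))
      where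
      open ≡-Reasoning
      L₁ = filter (λ j → ¬? (j ≟ (P ∸ 1) / 4)) (upTo P)
      L₂ = upTo (k * 4)
      numerator : 4 ^ (k * 4) * product (map (λ j → g n j * g n j) L₁) * product (map (λ _ → 1) L₂)
                ≡ 4 ^ (k * 4) * (N n * N n)
      numerator = begin
        4 ^ (k * 4) * product (map (λ j → g n j * g n j) L₁) * product (map (λ _ → 1) L₂)
          ≡⟨ cong₂ (λ a b → 4 ^ (k * 4) * a * b) (product-map-* (g n) (g n) L₁) (product-map-1 L₂) ⟩
        4 ^ (k * 4) * (product (map (g n) L₁) * product (map (g n) L₁)) * 1
          ≡⟨ *-identityʳ _ ⟩
        4 ^ (k * 4) * (product (map (g n) L₁) * product (map (g n) L₁))
          ≡⟨ cong (λ a → 4 ^ (k * 4) * (a * a)) (N-list n) ⟩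
        4 ^ (k * 4) * (N n * N n) ∎
      denominator : 1 * product (map (λ _ → 1) L₁) * product (map (λ i → h n i * h n i) L₂) ≡ D n * D n
      denominator = begin
        1 * product (map (λ _ → 1) L₁) * product (map (λ i → h n i * h n i) L₂)
          ≡⟨ cong₂ (λ a b → 1 * a * b) (product-map-1 L₁) (product-map-* (h n) (h n) L₂) ⟩
        1 * 1 * (product (map (h n) L₂) * product (map (h n) L₂))
          ≡⟨ *-identityˡ _ ⟩
        product (map (h n) L₂) * product (map (h n) L₂)
          ≡⟨ cong (λ a → a * a) (product-applyUpTo (h n) (λ i → i) (k * 4)) ⟩
        D n * D n ∎

    P∤D² : Prime P → ∀ n → ¬ P ∣ D n * D n
    P∤D² P-prime n P∣D² = [ P∤D , P∤D ] (euclidsLemma (D n) (D n) P-prime P∣D²)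
      where
      P∤D : ¬ P ∣ D n
      P∤D = prime∤Π (h n) (k * 4) P-prime (λ i i<4k P∣h →
        <⇒≱ (s≤s i<4k) (∣⇒≤ (∣m+n∣m⇒∣n (subst (P ∣_) (+-comm (suc i) (n * P)) P∣h) (n∣m*n n))))

    -- Both parts of the corollary: F(n) and F(0), and F(0) and 1 = 1/1, are pairs of
    -- fractions a/b with a ≡ b (mod P²) and P ∤ b.
    corollary-for : Prime P → Claim P
    corollary-for P-prime =
      (λ n _ → fractions-≡-mod P-prime (F-fraction n) (F-fraction 0) (numerator≡denominator n)
                               (numerator≡denominator 0) (P∤D² P-prime n) (P∤D² P-prime 0))
      , fractions-≡-mod {y = 1ℚ} P-prime (F-fraction 0) (cross refl) (numerator≡denominator 0) (≡mod-refl 1)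
                        (P∤D² P-prime 0) (prime∤1 P-prime)

open Specialisation using (Claim; module Setting)

corollary4p2 : (p : ℕ) → Prime p → p % 4 ≡ 1 →
    ((n : ℕ) → n ≥ 1 → F p n ≡ F p 0 [mod p ^ 2 ])
    × (F p 0 ≡ 1ℚ [mod p ^ 2 ])
corollary4p2 p p-prime p≡1[4] =
  subst Claim (sym p≡4k+1) (Setting.corollary-for (p / 4) (subst Prime p≡4k+1 p-prime))
  where
  p≡4k+1 : p ≡ suc (p / 4 * 4)
  p≡4k+1 = trans (m≡m%n+[m/n]*n p 4) (cong (_+ p / 4 * 4) p≡1[4])
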